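{- Let $L_2(n)$ denote the number of $2$-by-$n$ Latin rectangles on $\{1,\dots,n\}$, $n\ge1$. Then \[ L_2(n)=\sum_{s_{00}+s_{10}+s_{01}+s_{11}=n}(-1)^{s_{10}+s_{01}+2s_{11}}\binom{n}{s_{00},s_{10},s_{01},s_{11}}\big[(s_{00}+s_{10})(s_{00}+s_{01})-s_{11}\big]^n, \] where the sum is over nonnegative integers and the binomial symbol is the multinomial coefficient.
   Context: A $k$-by-$n$ Latin rectangle on $\{1,\dots,n\}$ is a $k\times n$ matrix with entries in $\{1,\dots,n\}$ such that no row and no column contains a repeated entry. -}

module Defs where

open import Data.Nat using (ℕ; zero; suc; _+_; _*_; _!; _/_; _≟_)
open import Data.Nat.Properties using (_!≢0; m*n≢0)
open import Data.Fin using (Fin)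
open import Data.Vec using (Vec; lookup)
open import Data.List using (List; []; _∷_; concatMap; map; filter; upTo; foldr)
open import Data.Integer as ℤ using (ℤ; +_; -_)
open import Data.Product using (_×_; _,_)
open import Relation.Binary.PropositionalEquality using (_≡_)

-- A k-by-n Latin rectangle on {1,…,n} (symbols represented by Fin n),
-- given as a vector of k rows, each a vector of n entries.
-- No row and no column contains a repeated entry.
IsLatin : (k n : ℕ) → Vec (Vec (Fin n) n) k → Set
IsLatin k n M =
  (∀ (i : Fin k) (j j′ : Fin n) → lookup (lookup M i) j ≡ lookup (lookup M i) j′ → j ≡ j′)
  × (∀ (j : Fin n) (i i′ : Fin k) → lookup (lookup M i) j ≡ lookup (lookup M i′) j → i ≡ i′)

-- The type of k-by-n Latin rectangles; the Latin property is an
-- irrelevant field, so two rectangles are equal iff their matrices are.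
record LatinRect (k n : ℕ) : Set where
  constructor latinRect
  field
    matrix : Vec (Vec (Fin n) n) k
    .isLatin : IsLatin k n matrix

multinomial4 : ℕ → ℕ → ℕ → ℕ → ℕ → ℕ
multinomial4 n a b c d = (n !) / ((a ! * b !) * (c ! * d !))
  where instance
    _ = a !≢0
    _ = b !≢0
    _ = c !≢0
    _ = d !≢0
    _ = m*n≢0 (a !) (b !)
    _ = m*n≢0 (c !) (d !)
    _ = m*n≢0 (a ! * b !) (c ! * d !)

compositions4 : ℕ → List (ℕ × ℕ × ℕ × ℕ)
compositions4 n =
  filter (λ { (a , b , c , d) → (a + b + c + d) ≟ n })
    (concatMap (λ a → concatMap (λ b → concatMap (λ c → map (λ d → (a , b , c , d))
      (upTo (suc n))) (upTo (suc n))) (upTo (suc n))) (upTo (suc n)))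

term : ℕ → ℕ × ℕ × ℕ × ℕ → ℤ
term n (s00 , s10 , s01 , s11) =
  ((- ℤ.1ℤ) ℤ.^ (s10 + s01 + 2 * s11))
  ℤ.* (+ multinomial4 n s00 s10 s01 s11)
  ℤ.* ((+ ((s00 + s10) * (s00 + s01)) ℤ.- + s11) ℤ.^ n)

formulaL2 : ℕ → ℤ
formulaL2 n = foldr ℤ._+_ (+ 0) (map (term n) (compositions4 n))

{-# OPTIONS --safe #-}

-- For two rows σ, τ : Fin n → Fin n, the indicator of being Latin is a double
-- inclusion–exclusion over subsets A, B of the symbols,
--   Σ_{A,B} (−1)^(|A|+|B|) ∏_j w(σ j ∈ A, τ j ∈ B, [σ j = τ j]).
-- If a row misses a symbol y, the summand does not depend on whether y lies in
-- A (resp. B), so the sum vanishes. Otherwise both rows are permutations and the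
-- sum factorises over the columns into ∏_j (1 − [σ j = τ j]).
-- Summed over all pairs of rows, the product over the columns becomes the n-th
-- power of Σ_{x,y} w(x ∈ A, y ∈ B, [x = y]) = |Ā| |B̄| − |A ∩ B|. This, like the
-- sign, depends only on the numbers s_ab of positions x with (x ∈ A, x ∈ B) = (a, b),
-- and there are n! / (s₀₀! s₁₀! s₀₁! s₁₁!) pairs (A, B) with given numbers.

module Submission where

open import Algebra.Bundles using (CommutativeSemiring)
import Algebra.Properties.CommutativeMonoid.Sum as MonoidSum
import Algebra.Properties.Semiring.Sum as SemiringSum
open import Data.Bool.Base using (true; false; T; if_then_else_)
open import Data.Bool.Properties using (T-irrelevant)
open import Data.Fin.Base using (Fin; zero; suc; toℕ; punchOut)
open import Data.Fin.Patterns using (0F; 1F; 2F; 3F)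
open import Data.Fin.Permutation using (Permutation; _⟨$⟩ʳ_; _⟨$⟩ˡ_; inverseˡ)
open import Data.Fin.Properties
  using (0↔⊥; 1↔⊤; +↔⊎; any?; all?; ¬∀⟶∃¬; punchOut-injective; injective⇒≤) renaming (_≟_ to _≟ᶠ_)
open import Data.List.Base using (List; []; _∷_; _++_; map; foldr; concatMap; filter; applyUpTo; upTo)
open import Data.Nat.Base as ℕ using (ℕ; zero; suc; _≤_; _<_; s<s; _!; NonZero)
import Data.Nat.DivMod as DivMod
open import Data.Nat.Properties as ℕₚ using () renaming (_≟_ to _≟ⁿ_)
import Data.Nat.Tactic.RingSolver as ℕ-Solver
open import Data.Product.Base using (Σ; _×_; _,_; ∃; proj₁; proj₂)
import Data.Product.Function.Dependent.Propositional as Σ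
open import Data.Sum.Algebra using (⊎-cong)
open import Data.Sum.Base using (_⊎_; inj₁; inj₂)
open import Data.Vec.Base using (Vec; []; _∷_; lookup; _[_]≔_)
open import Data.Vec.Functional using (removeAt)
open import Data.Vec.Properties using (lookup∘update′)
open import Function.Base using (_∘_)
open import Function.Bundles using (_⇔_; _↔_; mk⇔; mk↔ₛ′; Equivalence; Injection)
open import Function.Definitions using (Injective; StrictlyInverseˡ; StrictlyInverseʳ)
open import Function.Properties.Inverse using (↔-refl; ↔-sym; ↔-trans; ↔⇒↣)
open import Relation.Binary.Definitions using (DecidableEquality)
open import Relation.Binary.PropositionalEquality
  using (_≡_; _≢_; refl; sym; trans; cong; cong₂; module ≡-Reasoning)
open import Relation.Nullary.Decidable using (Dec; yes; no; does; recompute; map′; _×-dec_; _→-dec_)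
open import Relation.Nullary.Negation using (¬_; contradiction)

open import Defs

module FiniteSums {c ℓ} (R : CommutativeSemiring c ℓ) where

  open CommutativeSemiring R
    using ( Carrier; _≈_; _+_; _*_; 0#; 1#; setoid; semiring; *-commutativeMonoid
          ; *-comm; *-congˡ; *-congʳ; reflexive; +-congˡ; +-identityˡ; +-identityʳ; *-identityˡ; zeroˡ)
    renaming (refl to ≈-refl; sym to ≈-sym; trans to ≈-trans)
  open SemiringSum semiring public
  open import Relation.Binary.Reasoning.Setoid setoid

  module Product = MonoidSum *-commutativeMonoid

  ∏ : ∀ {n} → (Fin n → Carrier) → Carrier
  ∏ = Product.sum

  ∏-zero : ∀ {n} (f : Fin n → Carrier) i → f i ≈ 0# → ∏ f ≈ 0#
  ∏-zero {suc n} f i fᵢ≈0 = begin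
    ∏ f                             ≈⟨ Product.sum-remove {i = i} f ⟩
    f i * ∏ (removeAt f i)          ≈⟨ *-congʳ fᵢ≈0 ⟩
    0# * ∏ (removeAt f i)           ≈⟨ zeroˡ _ ⟩
    0#                              ∎

  ∏-one : ∀ {n} (f : Fin n → Carrier) → (∀ i → f i ≈ 1#) → ∏ f ≈ 1#
  ∏-one {n} f f≈1 = ≈-trans (Product.sum-cong-≋ f≈1) (Product.sum-replicate-zero n)

  ∏-reindex : ∀ {m n} (π : Permutation m n) (f : Fin m → Fin n → Carrier) →
              ∏ (λ j → f j (π ⟨$⟩ʳ j)) ≈ ∏ (λ x → f (π ⟨$⟩ˡ x) x)
  ∏-reindex π f =
    ≈-trans (Product.sum-cong-≋ (λ j → reflexive (cong (λ i → f i (π ⟨$⟩ʳ j)) (sym (inverseˡ π)))))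
            (≈-sym (Product.∑-permute (λ x → f (π ⟨$⟩ˡ x) x) π))

  𝟙 : ∀ {p} {P : Set p} → Dec P → Carrier
  𝟙 d = if does d then 1# else 0#

  𝟙-×-dec : ∀ {p q} {P : Set p} {Q : Set q} (p? : Dec P) (q? : Dec Q) →
            𝟙 (p? ×-dec q?) ≈ 𝟙 p? * 𝟙 q?
  𝟙-×-dec (yes _) (yes _) = ≈-sym (*-identityˡ 1#)
  𝟙-×-dec (yes _) (no _)  = ≈-sym (*-identityˡ 0#)
  𝟙-×-dec (no _)  q?      = ≈-sym (zeroˡ _)

  𝟙-*-subst : ∀ {a} {A : Set a} {x y : A} (f : A → Carrier) (x≟y : Dec (x ≡ y)) →
              𝟙 x≟y * f y ≈ 𝟙 x≟y * f x
  𝟙-*-subst f (yes refl) = ≈-refl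
  𝟙-*-subst f (no _)     = ≈-trans (zeroˡ _) (≈-sym (zeroˡ _))

  𝟙-yes : ∀ {p} {P : Set p} (p? : Dec P) → P → 𝟙 p? ≈ 1#
  𝟙-yes (yes _) _ = ≈-refl
  𝟙-yes (no ¬p) p = contradiction p ¬p

  𝟙-no : ∀ {p} {P : Set p} (p? : Dec P) → ¬ P → 𝟙 p? ≈ 0#
  𝟙-no (yes p) ¬p = contradiction p ¬p
  𝟙-no (no _)  _  = ≈-refl

  sum-𝟙-≟ : ∀ {n} (i : Fin n) → sum (λ j → 𝟙 (i ≟ᶠ j)) ≈ 1#
  sum-𝟙-≟ {suc n} zero    = ≈-trans (+-congˡ (sum-replicate-zero n)) (+-identityʳ 1#)
  sum-𝟙-≟ {suc n} (suc i) = ≈-trans (+-identityˡ _) (sum-𝟙-≟ i)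

  sum-𝟙-≟-* : ∀ {n} (i : Fin n) (f : Fin n → Carrier) → sum (λ j → 𝟙 (i ≟ᶠ j) * f j) ≈ f i
  sum-𝟙-≟-* {n} i f = begin
    sum (λ j → 𝟙 (i ≟ᶠ j) * f j)   ≈⟨ sum-cong-≋ {n} (λ j → 𝟙-*-subst f (i ≟ᶠ j)) ⟩
    sum (λ j → 𝟙 (i ≟ᶠ j) * f i)   ≈⟨ ≈-sym (*-distribʳ-sum (f i) (λ j → 𝟙 (i ≟ᶠ j))) ⟩
    sum (λ j → 𝟙 (i ≟ᶠ j)) * f i   ≈⟨ *-congʳ (sum-𝟙-≟ i) ⟩
    1# * f i                       ≈⟨ *-identityˡ (f i) ⟩
    f i                            ∎

  sum-𝟙-toℕ : ∀ {m} t → t < m → sum {m} (λ i → 𝟙 (t ≟ⁿ toℕ i)) ≈ 1#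
  sum-𝟙-toℕ {suc m} zero    _         = ≈-trans (+-congˡ (sum-replicate-zero m)) (+-identityʳ 1#)
  sum-𝟙-toℕ {suc m} (suc t) (s<s t<m) = ≈-trans (+-identityˡ _) (sum-𝟙-toℕ t t<m)

  sumVec : ∀ {k} m → (Vec (Fin k) m → Carrier) → Carrier
  sumVec zero    f = f []
  sumVec (suc m) f = sum (λ x → sumVec m (λ v → f (x ∷ v)))

  module _ {k : ℕ} where

    sumVec-cong : ∀ m {f g : Vec (Fin k) m → Carrier} → (∀ v → f v ≈ g v) → sumVec m f ≈ sumVec m g
    sumVec-cong zero    f≈g = f≈g []
    sumVec-cong (suc m) f≈g = sum-cong-≋ {k} (λ x → sumVec-cong m (λ v → f≈g (x ∷ v)))

    sumVec-zero : ∀ m {f : Vec (Fin k) m → Carrier} → (∀ v → f v ≈ 0#) → sumVec m f ≈ 0#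
    sumVec-zero zero    f≈0 = f≈0 []
    sumVec-zero (suc m) f≈0 =
      ≈-trans (sum-cong-≋ {k} (λ x → sumVec-zero m (λ v → f≈0 (x ∷ v)))) (sum-replicate-zero k)

    *-distribˡ-sumVec : ∀ m x (f : Vec (Fin k) m → Carrier) → x * sumVec m f ≈ sumVec m (λ v → x * f v)
    *-distribˡ-sumVec zero    x f = ≈-refl
    *-distribˡ-sumVec (suc m) x f =
      ≈-trans (*-distribˡ-sum {k} x _) (sum-cong-≋ {k} (λ y → *-distribˡ-sumVec m x _))

    *-distribʳ-sumVec : ∀ m x (f : Vec (Fin k) m → Carrier) → sumVec m f * x ≈ sumVec m (λ v → f v * x)
    *-distribʳ-sumVec m x f = begin
      sumVec m f * x              ≈⟨ *-comm _ x ⟩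
      x * sumVec m f              ≈⟨ *-distribˡ-sumVec m x f ⟩
      sumVec m (λ v → x * f v)    ≈⟨ sumVec-cong m (λ v → *-comm x (f v)) ⟩
      sumVec m (λ v → f v * x)    ∎

    sum-sumVec-comm : ∀ {l} m (f : Fin l → Vec (Fin k) m → Carrier) →
                      sum (λ i → sumVec m (f i)) ≈ sumVec m (λ v → sum (λ i → f i v))
    sum-sumVec-comm zero    f = ≈-refl
    sum-sumVec-comm {l} (suc m) f =
      ≈-trans (∑-comm {l} {k} _) (sum-cong-≋ {k} (λ x → sum-sumVec-comm m (λ i v → f i (x ∷ v))))

  sumVec-comm : ∀ {k l} m n (f : Vec (Fin k) m → Vec (Fin l) n → Carrier) →
                sumVec m (λ u → sumVec n (f u)) ≈ sumVec n (λ v → sumVec m (λ u → f u v))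
  sumVec-comm zero    n f = ≈-refl
  sumVec-comm (suc m) n f = ≈-trans (sum-cong-≋ (λ x → sumVec-comm m n (λ u → f (x ∷ u))))
                                  (sum-sumVec-comm n (λ x v → sumVec m (λ u → f (x ∷ u) v)))

  sumVec-pull : ∀ {k l} m n (c : Vec (Fin l) n → Carrier) (f : Vec (Fin k) m → Vec (Fin l) n → Carrier) →
                sumVec m (λ u → sumVec n (λ v → c v * f u v)) ≈
                sumVec n (λ v → c v * sumVec m (λ u → f u v))
  sumVec-pull m n c f = ≈-trans (sumVec-comm m n (λ u v → c v * f u v))
                                (sumVec-cong n (λ v → ≈-sym (*-distribˡ-sumVec m (c v) (λ u → f u v))))

  sumVec-pull₂ : ∀ {k k′ l} m m′ n (c : Vec (Fin l) n → Carrier)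
                 (f : Vec (Fin k) m → Vec (Fin k′) m′ → Vec (Fin l) n → Carrier) →
                 sumVec m (λ u → sumVec m′ (λ u′ → sumVec n (λ v → c v * f u u′ v))) ≈
                 sumVec n (λ v → c v * sumVec m (λ u → sumVec m′ (λ u′ → f u u′ v)))
  sumVec-pull₂ m m′ n c f = ≈-trans (sumVec-cong m (λ u → sumVec-pull m′ n c (f u)))
                                    (sumVec-pull m n c (λ u v → sumVec m′ (λ u′ → f u u′ v)))

  sumVec-∏ : ∀ {k} n (g : Fin n → Fin k → Carrier) →
             sumVec n (λ v → ∏ (λ j → g j (lookup v j))) ≈ ∏ (λ j → sum (g j))
  sumVec-∏ zero    g = ≈-refl
  sumVec-∏ {k} (suc n) g = begin
    sum (λ x → sumVec n (λ v → g zero x * ∏ (λ j → g (suc j) (lookup v j))))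
      ≈⟨ sum-cong-≋ {k} (λ x → ≈-sym (*-distribˡ-sumVec n (g zero x) _)) ⟩
    sum (λ x → g zero x * sumVec n (λ v → ∏ (λ j → g (suc j) (lookup v j))))
      ≈⟨ sum-cong-≋ {k} (λ x → *-congˡ (sumVec-∏ {k} n (λ j → g (suc j)))) ⟩
    sum (λ x → g zero x * ∏ (λ j → sum (g (suc j))))
      ≈⟨ ≈-sym (*-distribʳ-sum {k} _ (g zero)) ⟩
    sum (g zero) * ∏ (λ j → sum (g (suc j)))   ∎

open import Data.Integer.Base using (ℤ; +_; -_; 0ℤ; 1ℤ; -1ℤ; _+_; _*_; _-_; _^_)
import Data.Integer.Properties as ℤₚ
open import Data.Integer.Tactic.RingSolver using (solve-∀)

open FiniteSums ℤₚ.+-*-commutativeSemiring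
open ≡-Reasoning

module ℕΣ = FiniteSums ℕₚ.+-*-commutativeSemiring

sum-neg : ∀ {n} (f : Fin n → ℤ) → sum (λ i → - f i) ≡ - sum f
sum-neg {n} f = begin
  sum (λ i → - f i)         ≡⟨ sum-cong-≋ {n} (λ i → sym (ℤₚ.-1*i≡-i (f i))) ⟩
  sum (λ i → -1ℤ * f i)     ≡⟨ sym (*-distribˡ-sum -1ℤ f) ⟩
  -1ℤ * sum f               ≡⟨ ℤₚ.-1*i≡-i (sum f) ⟩
  - sum f                   ∎

sum-difference : ∀ {n} (f g : Fin n → ℤ) → sum (λ i → f i - g i) ≡ sum f - sum g
sum-difference f g = trans (∑-distrib-+ f (λ i → - g i)) (cong (λ t → sum f + t) (sum-neg g))

∏-const : ∀ n c → ∏ {n} (λ _ → c) ≡ c ^ n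
∏-const zero    c = refl
∏-const (suc n) c = cong (c *_) (∏-const n c)

sumVec₂-∏ : ∀ {k l} n (W : Fin k → Fin l → ℤ) →
            sumVec n (λ r₀ → sumVec n (λ r₁ → ∏ (λ j → W (lookup r₀ j) (lookup r₁ j)))) ≡
            sum (λ x → sum (W x)) ^ n
sumVec₂-∏ {k} n W = begin
  sumVec n (λ r₀ → sumVec n (λ r₁ → ∏ (λ j → W (lookup r₀ j) (lookup r₁ j))))
    ≡⟨ sumVec-cong n (λ r₀ → sumVec-∏ n (λ j → W (lookup r₀ j))) ⟩
  sumVec n (λ r₀ → ∏ (λ j → sum (W (lookup r₀ j))))
    ≡⟨ sumVec-∏ {k} n (λ _ x → sum (W x)) ⟩
  ∏ {n} (λ _ → sum (λ x → sum (W x)))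
    ≡⟨ ∏-const n (sum (λ x → sum (W x))) ⟩
  sum (λ x → sum (W x)) ^ n   ∎

pos-sum : ∀ {k} (f : Fin k → ℕ) → + ℕΣ.sum f ≡ sum (λ i → + f i)
pos-sum {zero}  f = refl
pos-sum {suc k} f = cong (λ t → + f 0F + t) (pos-sum (λ i → f (suc i)))

pos-sumVec : ∀ {k} m (f : Vec (Fin k) m → ℕ) → + ℕΣ.sumVec m f ≡ sumVec m (λ v → + f v)
pos-sumVec zero    f = refl
pos-sumVec {k} (suc m) f =
  trans (pos-sum (λ x → ℕΣ.sumVec m (λ v → f (x ∷ v)))) (sum-cong-≋ {k} (λ x → pos-sumVec m (λ v → f (x ∷ v))))

pos-𝟙 : ∀ {p} {P : Set p} (p? : Dec P) → + ℕΣ.𝟙 p? ≡ 𝟙 p?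
pos-𝟙 (yes _) = refl
pos-𝟙 (no _)  = refl

listSum : ∀ {a} {X : Set a} → (X → ℤ) → List X → ℤ
listSum f xs = foldr _+_ 0ℤ (map f xs)

listSum-++ : ∀ {a} {X : Set a} (f : X → ℤ) xs ys → listSum f (xs ++ ys) ≡ listSum f xs + listSum f ys
listSum-++ f []       ys = sym (ℤₚ.+-identityˡ _)
listSum-++ f (x ∷ xs) ys = trans (cong (λ t → f x + t) (listSum-++ f xs ys)) (sym (ℤₚ.+-assoc (f x) _ _))

listSum-concatMap : ∀ {a b} {X : Set a} {Y : Set b} (f : Y → ℤ) (g : X → List Y) xs →
                    listSum f (concatMap g xs) ≡ listSum (λ x → listSum f (g x)) xs
listSum-concatMap f g []       = refl
listSum-concatMap f g (x ∷ xs) =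
  trans (listSum-++ f (g x) (concatMap g xs)) (cong (λ t → listSum f (g x) + t) (listSum-concatMap f g xs))

listSum-map : ∀ {a b} {X : Set a} {Y : Set b} (f : Y → ℤ) (g : X → Y) xs →
              listSum f (map g xs) ≡ listSum (λ x → f (g x)) xs
listSum-map f g []       = refl
listSum-map f g (x ∷ xs) = cong (λ t → f (g x) + t) (listSum-map f g xs)

listSum-filter : ∀ {a p} {X : Set a} {P : X → Set p} (P? : ∀ x → Dec (P x)) (f : X → ℤ) xs →
                 listSum f (filter P? xs) ≡ listSum (λ x → 𝟙 (P? x) * f x) xs
listSum-filter P? f []       = refl
listSum-filter P? f (x ∷ xs) with P? x
... | yes _ = cong₂ _+_ (sym (ℤₚ.*-identityˡ (f x))) (listSum-filter P? f xs)
... | no  _ = trans (listSum-filter P? f xs) (sym (ℤₚ.+-identityˡ _))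

listSum-applyUpTo : ∀ (f : ℕ → ℤ) g m → listSum f (applyUpTo g m) ≡ sum {m} (λ i → f (g (toℕ i)))
listSum-applyUpTo f g zero    = refl
listSum-applyUpTo f g (suc m) = cong (λ t → f (g 0) + t) (listSum-applyUpTo f (λ i → g (suc i)) m)

listSum-upTo : ∀ (f : ℕ → ℤ) m → listSum f (upTo m) ≡ sum {m} (λ i → f (toℕ i))
listSum-upTo f = listSum-applyUpTo f (λ i → i)

listSum-concatMap-upTo : ∀ {b} {Y : Set b} (f : Y → ℤ) (g : ℕ → List Y) m →
                         listSum f (concatMap g (upTo m)) ≡ sum {m} (λ i → listSum f (g (toℕ i)))
listSum-concatMap-upTo f g m = trans (listSum-concatMap f g (upTo m)) (listSum-upTo (λ a → listSum f (g a)) m)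

listSum-map-upTo : ∀ {b} {Y : Set b} (f : Y → ℤ) (g : ℕ → Y) m →
                   listSum f (map g (upTo m)) ≡ sum {m} (λ i → f (g (toℕ i)))
listSum-map-upTo f g m = trans (listSum-map f g (upTo m)) (listSum-upTo (λ a → f (g a)) m)

T↔Fin : ∀ b → T b ↔ Fin (if b then 1 else 0)
T↔Fin true  = ↔-sym 1↔⊤
T↔Fin false = ↔-sym 0↔⊥

T-does : ∀ {p} {P : Set p} (p? : Dec P) → T (does p?) ⇔ P
T-does (yes p) = mk⇔ (λ _ → p) _
T-does (no ¬p) = mk⇔ (λ ()) ¬p

Σ-Fin-suc↔ : ∀ {k p} (P : Fin (suc k) → Set p) → Σ (Fin (suc k)) P ↔ (P zero ⊎ Σ (Fin k) (P ∘ suc))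
Σ-Fin-suc↔ P =
  mk↔ₛ′ to from (λ { (inj₁ _) → refl ; (inj₂ _) → refl }) (λ { (zero , _) → refl ; (suc _ , _) → refl })
  where
  to : Σ (Fin _) P → P zero ⊎ Σ (Fin _) (P ∘ suc)
  to (zero  , p) = inj₁ p
  to (suc i , p) = inj₂ (i , p)
  from : P zero ⊎ Σ (Fin _) (P ∘ suc) → Σ (Fin _) P
  from (inj₁ p)       = zero , p
  from (inj₂ (i , p)) = suc i , p

Σ-Fin↔ : ∀ {k} (c : Fin k → ℕ) → Σ (Fin k) (λ i → Fin (c i)) ↔ Fin (ℕΣ.sum c)
Σ-Fin↔ {zero}  c = mk↔ₛ′ (λ ()) (λ ()) (λ ()) (λ ())
Σ-Fin↔ {suc k} c =
  ↔-trans (Σ-Fin-suc↔ (λ i → Fin (c i))) (↔-trans (⊎-cong ↔-refl (Σ-Fin↔ (c ∘ suc))) (↔-sym +↔⊎))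

Σ-Vec-zero↔ : ∀ {a p} {X : Set a} (P : Vec X 0 → Set p) → Σ (Vec X 0) P ↔ P []
Σ-Vec-zero↔ P = mk↔ₛ′ (λ { ([] , p) → p }) ([] ,_) (λ _ → refl) (λ { ([] , _) → refl })

Σ-Vec-suc↔ : ∀ {a p m} {X : Set a} (P : Vec X (suc m) → Set p) →
             Σ (Vec X (suc m)) P ↔ Σ X (λ x → Σ (Vec X m) (λ v → P (x ∷ v)))
Σ-Vec-suc↔ P =
  mk↔ₛ′ (λ { ((x ∷ v) , p) → x , v , p }) (λ (x , v , p) → (x ∷ v) , p) (λ _ → refl) (λ { ((_ ∷ _) , _) → refl })

Σ-sumVec↔ : ∀ {k} m (c : Vec (Fin k) m → ℕ) → Σ (Vec (Fin k) m) (λ v → Fin (c v)) ↔ Fin (ℕΣ.sumVec m c)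
Σ-sumVec↔ zero    c = Σ-Vec-zero↔ (λ v → Fin (c v))
Σ-sumVec↔ (suc m) c = ↔-trans (Σ-Vec-suc↔ (λ v → Fin (c v)))
                     (↔-trans (Σ.congˡ (Σ-sumVec↔ m (λ v → c (_ ∷ v)))) (Σ-Fin↔ _))

-- Alternating sums over subsets

-- A subset A of Fin m is a vector of bits, lookup A x ≡ 1F meaning x ∈ A.
sg : Fin 2 → ℤ
sg 0F = 1ℤ
sg 1F = -1ℤ

sgn : ∀ {m} → Vec (Fin 2) m → ℤ
sgn A = ∏ (λ x → sg (lookup A x))

∇ : (Fin 2 → ℤ) → ℤ
∇ f = f 0F - f 1F

alternatingSum : ∀ m → (Vec (Fin 2) m → ℤ) → ℤ
alternatingSum m f = sumVec m (λ A → sgn A * f A)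

alternatingSum-cong : ∀ m {f g : Vec (Fin 2) m → ℤ} → (∀ A → f A ≡ g A) →
                      alternatingSum m f ≡ alternatingSum m g
alternatingSum-cong m f≡g = sumVec-cong m (λ A → cong (sgn A *_) (f≡g A))

alternatingSum-zero : ∀ m {f : Vec (Fin 2) m → ℤ} → (∀ A → f A ≡ 0ℤ) → alternatingSum m f ≡ 0ℤ
alternatingSum-zero m f≡0 = sumVec-zero m (λ A → trans (cong (sgn A *_) (f≡0 A)) (ℤₚ.*-zeroʳ (sgn A)))

sum-sg-* : ∀ f → sum (λ b → sg b * f b) ≡ ∇ f
sum-sg-* f = lemma (f 0F) (f 1F)
  where
  lemma : ∀ x y → 1ℤ * x + (-1ℤ * y + 0ℤ) ≡ x - y
  lemma = solve-∀

alternatingSum-cons : ∀ {m} (f : Vec (Fin 2) (suc m) → ℤ) →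
                      alternatingSum (suc m) f ≡ ∇ (λ a → alternatingSum m (λ A → f (a ∷ A)))
alternatingSum-cons {m} f = begin
  alternatingSum (suc m) f
    ≡⟨ sum-cong-≋ {2} (λ a → trans (sumVec-cong m (λ A → ℤₚ.*-assoc (sg a) (sgn A) (f (a ∷ A))))
                                   (sym (*-distribˡ-sumVec m (sg a) (λ A → sgn A * f (a ∷ A))))) ⟩
  sum (λ a → sg a * alternatingSum m (λ A → f (a ∷ A)))
    ≡⟨ sum-sg-* (λ a → alternatingSum m (λ A → f (a ∷ A))) ⟩
  ∇ (λ a → alternatingSum m (λ A → f (a ∷ A)))   ∎

alternatingSum-constant-at : ∀ {m} (x : Fin m) (f : Vec (Fin 2) m → ℤ) →
                             (∀ A b → f (A [ x ]≔ b) ≡ f A) → alternatingSum m f ≡ 0ℤ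
alternatingSum-constant-at {suc m} zero f f-const = begin
  alternatingSum (suc m) f    ≡⟨ alternatingSum-cons f ⟩
  S 0F - S 1F                 ≡⟨ cong (λ t → S 0F - t) (alternatingSum-cong m (λ A → f-const (0F ∷ A) 1F)) ⟩
  S 0F - S 0F                 ≡⟨ ℤₚ.+-inverseʳ (S 0F) ⟩
  0ℤ                          ∎
  where
  S : Fin 2 → ℤ
  S a = alternatingSum m (λ A → f (a ∷ A))
alternatingSum-constant-at {suc m} (suc x) f f-const = begin
  alternatingSum (suc m) f                        ≡⟨ alternatingSum-cons f ⟩
  ∇ (λ a → alternatingSum m (λ A → f (a ∷ A)))    ≡⟨ cong₂ _-_ (vanishes 0F) (vanishes 1F) ⟩
  0ℤ                                              ∎
  where
  vanishes : ∀ a → alternatingSum m (λ A → f (a ∷ A)) ≡ 0ℤ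
  vanishes a = alternatingSum-constant-at x (λ A → f (a ∷ A)) (λ A → f-const (a ∷ A))

alternatingSum-∏ : ∀ {m} (g : Fin m → Fin 2 → ℤ) →
                   alternatingSum m (λ A → ∏ (λ x → g x (lookup A x))) ≡ ∏ (λ x → ∇ (g x))
alternatingSum-∏ {m} g = begin
  alternatingSum m (λ A → ∏ (λ x → g x (lookup A x)))
    ≡⟨ sumVec-cong m (λ A → sym (Product.∑-distrib-+ (λ x → sg (lookup A x)) (λ x → g x (lookup A x)))) ⟩
  sumVec m (λ A → ∏ (λ x → sg (lookup A x) * g x (lookup A x)))
    ≡⟨ sumVec-∏ m (λ x b → sg b * g x b) ⟩
  ∏ (λ x → sum (λ b → sg b * g x b))
    ≡⟨ Product.sum-cong-≋ (λ x → sum-sg-* (g x)) ⟩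
  ∏ (λ x → ∇ (g x))   ∎

alternatingSum-permute : ∀ {m n} (π : Permutation m n) (F : Fin m → Fin 2 → ℤ) →
                         alternatingSum n (λ A → ∏ (λ j → F j (lookup A (π ⟨$⟩ʳ j)))) ≡ ∏ (λ j → ∇ (F j))
alternatingSum-permute {n = n} π F = begin
  alternatingSum n (λ A → ∏ (λ j → F j (lookup A (π ⟨$⟩ʳ j))))
    ≡⟨ alternatingSum-cong n (λ A → ∏-reindex π (λ j x → F j (lookup A x))) ⟩
  alternatingSum n (λ A → ∏ (λ x → F (π ⟨$⟩ˡ x) (lookup A x)))
    ≡⟨ alternatingSum-∏ (λ x → F (π ⟨$⟩ˡ x)) ⟩
  ∏ (λ x → ∇ (F (π ⟨$⟩ˡ x)))
    ≡⟨ sym (∏-reindex π (λ j _ → ∇ (F j))) ⟩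
  ∏ (λ j → ∇ (F j))   ∎

injective⇒surjective : ∀ {n} {f : Fin n → Fin n} → Injective _≡_ _≡_ f → ∀ y → ∃ λ x → f x ≡ y
injective⇒surjective {suc n} {f} f-inj y with any? (λ x → f x ≟ᶠ y)
... | yes hit  = hit
... | no  miss = contradiction (injective⇒≤ f′-inj) ℕₚ.1+n≰n
  where
  y≢f : ∀ x → y ≢ f x
  y≢f x y≡fx = miss (x , sym y≡fx)
  f′ : Fin (suc n) → Fin n
  f′ x = punchOut (y≢f x)
  f′-inj : Injective _≡_ _≡_ f′
  f′-inj = f-inj ∘ punchOut-injective (y≢f _) (y≢f _)

missing⇒¬injective : ∀ {n} {f : Fin n → Fin n} y → (∀ x → f x ≢ y) → ¬ Injective _≡_ _≡_ f
missing⇒¬injective y f∌y f-inj with x , fx≡y ← injective⇒surjective f-inj y = f∌y x fx≡y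

data PermutationOrMissing {n} (σ : Fin n → Fin n) : Set where
  permutation : (ρ : Fin n → Fin n) → StrictlyInverseˡ _≡_ σ ρ → StrictlyInverseʳ _≡_ σ ρ →
                PermutationOrMissing σ
  missing     : (y : Fin n) → (∀ x → σ x ≢ y) → PermutationOrMissing σ

permutationOrMissing : ∀ {n} (σ : Fin n → Fin n) → PermutationOrMissing σ
permutationOrMissing {n} σ with all? (λ y → any? (λ x → σ x ≟ᶠ y))
... | yes onto = permutation ρ σρ ρσ
  where
  ρ : Fin n → Fin n
  ρ y = proj₁ (onto y)
  σρ : StrictlyInverseˡ _≡_ σ ρ
  σρ y = proj₂ (onto y)
  ρ-inj : Injective _≡_ _≡_ ρ
  ρ-inj {y} {y′} ρy≡ρy′ = trans (sym (σρ y)) (trans (cong σ ρy≡ρy′) (σρ y′))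
  ρσ : StrictlyInverseʳ _≡_ σ ρ
  ρσ x with y , ρy≡x ← injective⇒surjective ρ-inj x =
    trans (cong (ρ ∘ σ) (sym ρy≡x)) (trans (cong ρ (σρ y)) ρy≡x)
... | no ¬onto with y , y∉σ ← ¬∀⟶∃¬ n _ (λ y → any? (λ x → σ x ≟ᶠ y)) ¬onto =
  missing y (λ x σx≡y → y∉σ (x , σx≡y))

-- The Latin indicator of two rows

latin? : ∀ {k n} (M : Vec (Vec (Fin n) n) k) → Dec (IsLatin k n M)
latin? M =
  all? (λ i → all? (λ j → all? (λ j′ →
    (lookup (lookup M i) j ≟ᶠ lookup (lookup M i) j′) →-dec (j ≟ᶠ j′))))
  ×-dec
  all? (λ j → all? (λ i → all? (λ i′ →
    (lookup (lookup M i) j ≟ᶠ lookup (lookup M i′) j) →-dec (i ≟ᶠ i′))))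

IsLatin₂⇔ : ∀ {n} (r₀ r₁ : Vec (Fin n) n) →
            IsLatin 2 n (r₀ ∷ r₁ ∷ []) ⇔
            (Injective _≡_ _≡_ (lookup r₀) × Injective _≡_ _≡_ (lookup r₁) ×
             (∀ j → lookup r₀ j ≢ lookup r₁ j))
IsLatin₂⇔ r₀ r₁ = mk⇔ (λ (rows , cols) → rows 0F _ _ , rows 1F _ _ , λ j eq → 0≢1 (cols j 0F 1F eq))
                      (λ (r₀-inj , r₁-inj , distinct) → rows r₀-inj r₁-inj , cols distinct)
  where
  M : Vec (Vec (Fin _) _) 2
  M = r₀ ∷ r₁ ∷ []
  0≢1 : 0F ≢ 1F
  0≢1 ()
  rows : Injective _≡_ _≡_ (lookup r₀) → Injective _≡_ _≡_ (lookup r₁) →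
         ∀ i j j′ → lookup (lookup M i) j ≡ lookup (lookup M i) j′ → j ≡ j′
  rows r₀-inj r₁-inj 0F j j′ = r₀-inj
  rows r₀-inj r₁-inj 1F j j′ = r₁-inj
  cols : (∀ j → lookup r₀ j ≢ lookup r₁ j) →
         ∀ j i i′ → lookup (lookup M i) j ≡ lookup (lookup M i′) j → i ≡ i′
  cols distinct j 0F 0F _  = refl
  cols distinct j 0F 1F eq = contradiction eq (distinct j)
  cols distinct j 1F 0F eq = contradiction (sym eq) (distinct j)
  cols distinct j 1F 1F _  = refl

outside inside : Fin 2 → ℤ
outside 0F = 1ℤ
outside 1F = 0ℤ
inside 0F = 0ℤ
inside 1F = 1ℤ

-- The weight is chosen so that its double difference is 1 − e (∇∇w), while its sum
-- over all (x , y) with e = [x = y] is |Ā| |B̄| − |A ∩ B| (totalWeight-cellCounts).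
w : Fin 2 → Fin 2 → ℤ → ℤ
w 0F b e = outside b
w 1F b e = - (e * inside b)

∇∇w : ∀ e → ∇ (λ a → ∇ (λ b → w a b e)) ≡ 1ℤ - e
∇∇w e = lemma e
  where
  lemma : ∀ e → (1ℤ - 0ℤ) - (- (e * 0ℤ) - - (e * 1ℤ)) ≡ 1ℤ - e
  lemma = solve-∀

latinWeight : ∀ {n} (σ τ : Fin n → Fin n) → ℤ
latinWeight {n} σ τ = alternatingSum n (λ A → alternatingSum n (λ B →
  ∏ (λ j → w (lookup A (σ j)) (lookup B (τ j)) (𝟙 (σ j ≟ᶠ τ j)))))

latinWeight-missingˡ : ∀ {n} {σ : Fin n → Fin n} (τ : Fin n → Fin n) y → (∀ x → σ x ≢ y) →
                       latinWeight σ τ ≡ 0ℤ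
latinWeight-missingˡ {n} {σ} τ y σ∌y = alternatingSum-constant-at y _ (λ A b →
  alternatingSum-cong n (λ B → Product.sum-cong-≋ (λ j →
    cong (λ a → w a (lookup B (τ j)) (𝟙 (σ j ≟ᶠ τ j))) (lookup∘update′ (σ∌y j) A b))))

latinWeight-missingʳ : ∀ {n} (σ : Fin n → Fin n) {τ : Fin n → Fin n} y → (∀ x → τ x ≢ y) →
                       latinWeight σ τ ≡ 0ℤ
latinWeight-missingʳ {n} σ {τ} y τ∌y = alternatingSum-zero n (λ A → alternatingSum-constant-at y _ (λ B b →
  Product.sum-cong-≋ (λ j →
    cong (λ b′ → w (lookup A (σ j)) b′ (𝟙 (σ j ≟ᶠ τ j))) (lookup∘update′ (τ∌y j) B b))))

latinWeight-permutations : ∀ {n} (π π′ : Permutation n n) →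
                           latinWeight (π ⟨$⟩ʳ_) (π′ ⟨$⟩ʳ_) ≡ ∏ (λ j → 1ℤ - 𝟙 (π ⟨$⟩ʳ j ≟ᶠ π′ ⟨$⟩ʳ j))
latinWeight-permutations {n} π π′ = begin
  latinWeight (π ⟨$⟩ʳ_) (π′ ⟨$⟩ʳ_)
    ≡⟨ alternatingSum-cong n (λ A → alternatingSum-permute π′ (λ j b → w (lookup A (π ⟨$⟩ʳ j)) b (e j))) ⟩
  alternatingSum n (λ A → ∏ (λ j → ∇ (λ b → w (lookup A (π ⟨$⟩ʳ j)) b (e j))))
    ≡⟨ alternatingSum-permute π (λ j a → ∇ (λ b → w a b (e j))) ⟩
  ∏ (λ j → ∇ (λ a → ∇ (λ b → w a b (e j))))
    ≡⟨ Product.sum-cong-≋ (λ j → ∇∇w (e j)) ⟩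
  ∏ (λ j → 1ℤ - e j)   ∎
  where
  e : Fin n → ℤ
  e j = 𝟙 (π ⟨$⟩ʳ j ≟ᶠ π′ ⟨$⟩ʳ j)

latin-indicator : ∀ {n} (r₀ r₁ : Vec (Fin n) n) →
                  𝟙 (latin? (r₀ ∷ r₁ ∷ [])) ≡ latinWeight (lookup r₀) (lookup r₁)
latin-indicator r₀ r₁ with permutationOrMissing (lookup r₀) | permutationOrMissing (lookup r₁)
... | missing y r₀∌y | _ =
  trans (𝟙-no (latin? (r₀ ∷ r₁ ∷ []))
               (missing⇒¬injective y r₀∌y ∘ proj₁ ∘ Equivalence.to (IsLatin₂⇔ r₀ r₁)))
        (sym (latinWeight-missingˡ (lookup r₁) y r₀∌y))
... | permutation _ _ _ | missing y r₁∌y =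
  trans (𝟙-no (latin? (r₀ ∷ r₁ ∷ []))
               (missing⇒¬injective y r₁∌y ∘ proj₁ ∘ proj₂ ∘ Equivalence.to (IsLatin₂⇔ r₀ r₁)))
        (sym (latinWeight-missingʳ (lookup r₀) y r₁∌y))
... | permutation ρ₀ inv₀ˡ inv₀ʳ | permutation ρ₁ inv₁ˡ inv₁ʳ =
  trans (by-clash (any? (λ j → lookup r₀ j ≟ᶠ lookup r₁ j))) (sym (latinWeight-permutations π₀ π₁))
  where
  π₀ π₁ : Permutation _ _
  π₀ = mk↔ₛ′ (lookup r₀) ρ₀ inv₀ˡ inv₀ʳ
  π₁ = mk↔ₛ′ (lookup r₁) ρ₁ inv₁ˡ inv₁ʳ
  by-clash : Dec (∃ λ j → lookup r₀ j ≡ lookup r₁ j) →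
             𝟙 (latin? (r₀ ∷ r₁ ∷ [])) ≡ ∏ (λ j → 1ℤ - 𝟙 (lookup r₀ j ≟ᶠ lookup r₁ j))
  by-clash (yes (j , clash)) =
    trans (𝟙-no (latin? (r₀ ∷ r₁ ∷ []))
                 (λ latin → proj₂ (proj₂ (Equivalence.to (IsLatin₂⇔ r₀ r₁) latin)) j clash))
          (sym (∏-zero _ j (cong (λ t → 1ℤ - t) (𝟙-yes (_ ≟ᶠ _) clash))))
  by-clash (no ¬clash) =
    trans (𝟙-yes (latin? (r₀ ∷ r₁ ∷ [])) (Equivalence.from (IsLatin₂⇔ r₀ r₁)
            (Injection.injective (↔⇒↣ π₀) , Injection.injective (↔⇒↣ π₁) , λ j clash → ¬clash (j , clash))))
          (sym (∏-one _ (λ j → cong (λ t → 1ℤ - t) (𝟙-no (_ ≟ᶠ _) (λ clash → ¬clash (j , clash))))))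

totalWeight : ∀ {m} → Vec (Fin 2) m → Vec (Fin 2) m → ℤ
totalWeight A B = sum (λ x → sum (λ y → w (lookup A x) (lookup B y) (𝟙 (x ≟ᶠ y))))

latinCount-alternating : ∀ n →
  sumVec n (λ r₀ → sumVec n (λ r₁ → 𝟙 (latin? (r₀ ∷ r₁ ∷ [])))) ≡
  alternatingSum n (λ A → alternatingSum n (λ B → totalWeight A B ^ n))
latinCount-alternating n = begin
  sumVec n (λ r₀ → sumVec n (λ r₁ → 𝟙 (latin? (r₀ ∷ r₁ ∷ []))))
    ≡⟨ sumVec-cong n (λ r₀ → sumVec-cong n (λ r₁ → latin-indicator r₀ r₁)) ⟩
  sumVec n (λ r₀ → sumVec n (λ r₁ → alternatingSum n (λ A → alternatingSum n (λ B → P A B r₀ r₁))))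
    ≡⟨ sumVec-pull₂ n n n sgn (λ r₀ r₁ A → alternatingSum n (λ B → P A B r₀ r₁)) ⟩
  alternatingSum n (λ A → sumVec n (λ r₀ → sumVec n (λ r₁ → alternatingSum n (λ B → P A B r₀ r₁))))
    ≡⟨ alternatingSum-cong n (λ A → sumVec-pull₂ n n n sgn (λ r₀ r₁ B → P A B r₀ r₁)) ⟩
  alternatingSum n (λ A → alternatingSum n (λ B → sumVec n (λ r₀ → sumVec n (λ r₁ → P A B r₀ r₁))))
    ≡⟨ alternatingSum-cong n (λ A → alternatingSum-cong n (λ B →
         sumVec₂-∏ n (λ x y → w (lookup A x) (lookup B y) (𝟙 (x ≟ᶠ y))))) ⟩
  alternatingSum n (λ A → alternatingSum n (λ B → totalWeight A B ^ n))   ∎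
  where
  P : Vec (Fin 2) n → Vec (Fin 2) n → Vec (Fin n) n → Vec (Fin n) n → ℤ
  P A B r₀ r₁ = ∏ (λ j → w (lookup A (lookup r₀ j)) (lookup B (lookup r₁ j))
                           (𝟙 (lookup r₀ j ≟ᶠ lookup r₁ j)))

-- Cell counts of a pair of subsets

-- (s₀₀ , s₁₀ , s₀₁ , s₁₁), where s_ab is the number of positions x with lookup A x ≡ a
-- and lookup B x ≡ b.
Counts : Set
Counts = ℕ × ℕ × ℕ × ℕ

bump : Fin 2 → Fin 2 → Counts → Counts
bump 0F 0F (s₀₀ , s₁₀ , s₀₁ , s₁₁) = suc s₀₀ , s₁₀ , s₀₁ , s₁₁
bump 1F 0F (s₀₀ , s₁₀ , s₀₁ , s₁₁) = s₀₀ , suc s₁₀ , s₀₁ , s₁₁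
bump 0F 1F (s₀₀ , s₁₀ , s₀₁ , s₁₁) = s₀₀ , s₁₀ , suc s₀₁ , s₁₁
bump 1F 1F (s₀₀ , s₁₀ , s₀₁ , s₁₁) = s₀₀ , s₁₀ , s₀₁ , suc s₁₁

cellCounts : ∀ {m} → Vec (Fin 2) m → Vec (Fin 2) m → Counts
cellCounts []      []      = 0 , 0 , 0 , 0
cellCounts (a ∷ A) (b ∷ B) = bump a b (cellCounts A B)

_≟ᶜ_ : DecidableEquality Counts
(p , q , r , s) ≟ᶜ (p′ , q′ , r′ , s′) =
  map′ (λ { (refl , refl , refl , refl) → refl }) (λ { refl → refl , refl , refl , refl })
       (p ≟ⁿ p′ ×-dec q ≟ⁿ q′ ×-dec r ≟ⁿ r′ ×-dec s ≟ⁿ s′)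

cell : Fin 2 → Fin 2 → Counts → ℕ
cell 0F 0F (s₀₀ , _ , _ , _) = s₀₀
cell 1F 0F (_ , s₁₀ , _ , _) = s₁₀
cell 0F 1F (_ , _ , s₀₁ , _) = s₀₁
cell 1F 1F (_ , _ , _ , s₁₁) = s₁₁

total : Counts → ℕ
total (s₀₀ , s₁₀ , s₀₁ , s₁₁) = s₀₀ ℕ.+ s₁₀ ℕ.+ s₀₁ ℕ.+ s₁₁

sign : Counts → ℤ
sign (s₀₀ , s₁₀ , s₀₁ , s₁₁) = (- 1ℤ) ^ (s₁₀ ℕ.+ s₀₁ ℕ.+ 2 ℕ.* s₁₁)

base : Counts → ℤ
base (s₀₀ , s₁₀ , s₀₁ , s₁₁) = + ((s₀₀ ℕ.+ s₁₀) ℕ.* (s₀₀ ℕ.+ s₀₁)) - + s₁₁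

cellSum : (Fin 2 → Fin 2 → ℤ) → Counts → ℤ
cellSum h (s₀₀ , s₁₀ , s₀₁ , s₁₁) = + s₀₀ * h 0F 0F + + s₁₀ * h 1F 0F + + s₀₁ * h 0F 1F + + s₁₁ * h 1F 1F

total-bump : ∀ a b s → total (bump a b s) ≡ suc (total s)
total-bump 0F 0F _                     = refl
total-bump 1F 0F (s₀₀ , s₁₀ , s₀₁ , s₁₁) = lemma s₀₀ s₁₀ s₀₁ s₁₁
  where
  lemma : ∀ p q r s → p ℕ.+ suc q ℕ.+ r ℕ.+ s ≡ suc (p ℕ.+ q ℕ.+ r ℕ.+ s)
  lemma = ℕ-Solver.solve-∀
total-bump 0F 1F (s₀₀ , s₁₀ , s₀₁ , s₁₁) = lemma s₀₀ s₁₀ s₀₁ s₁₁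
  where
  lemma : ∀ p q r s → p ℕ.+ q ℕ.+ suc r ℕ.+ s ≡ suc (p ℕ.+ q ℕ.+ r ℕ.+ s)
  lemma = ℕ-Solver.solve-∀
total-bump 1F 1F (s₀₀ , s₁₀ , s₀₁ , s₁₁) = ℕₚ.+-suc (s₀₀ ℕ.+ s₁₀ ℕ.+ s₀₁) s₁₁

sign-bump : ∀ a b s → sign (bump a b s) ≡ sg a * sg b * sign s
sign-bump 0F 0F _                       = sym (ℤₚ.*-identityˡ _)
sign-bump 1F 0F _                       = refl
sign-bump 0F 1F (s₀₀ , s₁₀ , s₀₁ , s₁₁) = cong (λ k → (- 1ℤ) ^ (k ℕ.+ 2 ℕ.* s₁₁)) (ℕₚ.+-suc s₁₀ s₀₁)
sign-bump 1F 1F (s₀₀ , s₁₀ , s₀₁ , s₁₁) =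
  trans (cong ((- 1ℤ) ^_) (exponent s₁₀ s₀₁ s₁₁)) (twice-negate ((- 1ℤ) ^ (s₁₀ ℕ.+ s₀₁ ℕ.+ 2 ℕ.* s₁₁)))
  where
  exponent : ∀ p q r → p ℕ.+ q ℕ.+ 2 ℕ.* suc r ≡ suc (suc (p ℕ.+ q ℕ.+ 2 ℕ.* r))
  exponent = ℕ-Solver.solve-∀
  twice-negate : ∀ x → - 1ℤ * (- 1ℤ * x) ≡ 1ℤ * x
  twice-negate = solve-∀

cellSum-bump : ∀ h a b s → cellSum h (bump a b s) ≡ h a b + cellSum h s
cellSum-bump h 0F 0F (s₀₀ , s₁₀ , s₀₁ , s₁₁) =
  lemma (+ s₀₀) (+ s₁₀) (+ s₀₁) (+ s₁₁) (h 0F 0F) (h 1F 0F) (h 0F 1F) (h 1F 1F)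
  where
  lemma : ∀ p q r s a b c d → (1ℤ + p) * a + q * b + r * c + s * d ≡ a + (p * a + q * b + r * c + s * d)
  lemma = solve-∀
cellSum-bump h 1F 0F (s₀₀ , s₁₀ , s₀₁ , s₁₁) =
  lemma (+ s₀₀) (+ s₁₀) (+ s₀₁) (+ s₁₁) (h 0F 0F) (h 1F 0F) (h 0F 1F) (h 1F 1F)
  where
  lemma : ∀ p q r s a b c d → p * a + (1ℤ + q) * b + r * c + s * d ≡ b + (p * a + q * b + r * c + s * d)
  lemma = solve-∀
cellSum-bump h 0F 1F (s₀₀ , s₁₀ , s₀₁ , s₁₁) =
  lemma (+ s₀₀) (+ s₁₀) (+ s₀₁) (+ s₁₁) (h 0F 0F) (h 1F 0F) (h 0F 1F) (h 1F 1F)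
  where
  lemma : ∀ p q r s a b c d → p * a + q * b + (1ℤ + r) * c + s * d ≡ c + (p * a + q * b + r * c + s * d)
  lemma = solve-∀
cellSum-bump h 1F 1F (s₀₀ , s₁₀ , s₀₁ , s₁₁) =
  lemma (+ s₀₀) (+ s₁₀) (+ s₀₁) (+ s₁₁) (h 0F 0F) (h 1F 0F) (h 0F 1F) (h 1F 1F)
  where
  lemma : ∀ p q r s a b c d → p * a + q * b + r * c + (1ℤ + s) * d ≡ d + (p * a + q * b + r * c + s * d)
  lemma = solve-∀

total-cellCounts : ∀ {m} (A B : Vec (Fin 2) m) → total (cellCounts A B) ≡ m
total-cellCounts []      []      = refl
total-cellCounts (a ∷ A) (b ∷ B) = trans (total-bump a b (cellCounts A B)) (cong suc (total-cellCounts A B))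

sgn-cellCounts : ∀ {m} (A B : Vec (Fin 2) m) → sgn A * sgn B ≡ sign (cellCounts A B)
sgn-cellCounts []      []      = refl
sgn-cellCounts (a ∷ A) (b ∷ B) = begin
  (sg a * sgn A) * (sg b * sgn B)   ≡⟨ interchange (sg a) (sgn A) (sg b) (sgn B) ⟩
  sg a * sg b * (sgn A * sgn B)     ≡⟨ cong (sg a * sg b *_) (sgn-cellCounts A B) ⟩
  sg a * sg b * sign (cellCounts A B) ≡⟨ sym (sign-bump a b (cellCounts A B)) ⟩
  sign (cellCounts (a ∷ A) (b ∷ B)) ∎
  where
  interchange : ∀ p q r s → (p * q) * (r * s) ≡ p * r * (q * s)
  interchange = solve-∀

sum-cellCounts : ∀ {m} h (A B : Vec (Fin 2) m) →
                 sum (λ x → h (lookup A x) (lookup B x)) ≡ cellSum h (cellCounts A B)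
sum-cellCounts h []      []      = refl
sum-cellCounts h (a ∷ A) (b ∷ B) =
  trans (cong (λ t → h a b + t) (sum-cellCounts h A B)) (sym (cellSum-bump h a b (cellCounts A B)))

sum-w : ∀ {m} a x (B : Vec (Fin 2) m) →
        sum (λ y → w a (lookup B y) (𝟙 (x ≟ᶠ y))) ≡
        outside a * sum (λ y → outside (lookup B y)) - inside a * inside (lookup B x)
sum-w 0F x B = sym (trans (ℤₚ.+-identityʳ _) (ℤₚ.*-identityˡ _))
sum-w 1F x B = begin
  sum (λ y → - (𝟙 (x ≟ᶠ y) * inside (lookup B y)))
    ≡⟨ sum-neg (λ y → 𝟙 (x ≟ᶠ y) * inside (lookup B y)) ⟩
  - sum (λ y → 𝟙 (x ≟ᶠ y) * inside (lookup B y))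
    ≡⟨ cong -_ (sum-𝟙-≟-* x (λ y → inside (lookup B y))) ⟩
  - inside (lookup B x)
    ≡⟨ sym (trans (ℤₚ.+-identityˡ _) (cong -_ (ℤₚ.*-identityˡ _))) ⟩
  0ℤ - 1ℤ * inside (lookup B x)   ∎

totalWeight-cellCounts : ∀ {m} (A B : Vec (Fin 2) m) → totalWeight A B ≡ base (cellCounts A B)
totalWeight-cellCounts {m} A B = begin
  totalWeight A B
    ≡⟨ sum-cong-≋ {m} (λ x → sum-w (lookup A x) x B) ⟩
  sum (λ x → outside (lookup A x) * #B̄ - inside (lookup A x) * inside (lookup B x))
    ≡⟨ sum-difference (λ x → outside (lookup A x) * #B̄) (λ x → inside (lookup A x) * inside (lookup B x)) ⟩
  sum (λ x → outside (lookup A x) * #B̄) - #A∩B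
    ≡⟨ cong (_- #A∩B) (sym (*-distribʳ-sum #B̄ (λ x → outside (lookup A x)))) ⟩
  #Ā * #B̄ - #A∩B
    ≡⟨ cong₂ _-_ (cong₂ _*_ (sum-cellCounts (λ a _ → outside a) A B) (sum-cellCounts (λ _ b → outside b) A B))
                 (sum-cellCounts (λ a b → inside a * inside b) A B) ⟩
  cellSum (λ a _ → outside a) t * cellSum (λ _ b → outside b) t - cellSum (λ a b → inside a * inside b) t
    ≡⟨ cellSums-base t ⟩
  base t   ∎
  where
  t : Counts
  t = cellCounts A B
  #Ā #B̄ #A∩B : ℤ
  #Ā   = sum (λ x → outside (lookup A x))
  #B̄   = sum (λ y → outside (lookup B y))
  #A∩B = sum (λ x → inside (lookup A x) * inside (lookup B x))
  cellSums-base : ∀ t → cellSum (λ a _ → outside a) t * cellSum (λ _ b → outside b) t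
                        - cellSum (λ a b → inside a * inside b) t ≡ base t
  cellSums-base (s₀₀ , s₁₀ , s₀₁ , s₁₁) =
    trans (lemma (+ s₀₀) (+ s₁₀) (+ s₀₁) (+ s₁₁)) (cong (_- + s₁₁) (sym (ℤₚ.pos-* (s₀₀ ℕ.+ s₁₀) (s₀₀ ℕ.+ s₀₁))))
    where
    lemma : ∀ p q r s → (p * 1ℤ + q * 0ℤ + r * 1ℤ + s * 0ℤ) * (p * 1ℤ + q * 1ℤ + r * 0ℤ + s * 0ℤ)
                        - (p * 0ℤ + q * 0ℤ + r * 0ℤ + s * 1ℤ) ≡ (p + q) * (p + r) - s
    lemma = solve-∀

alternatingSum-cellCounts : ∀ n →
  alternatingSum n (λ A → alternatingSum n (λ B → totalWeight A B ^ n)) ≡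
  sumVec n (λ A → sumVec n (λ B → sign (cellCounts A B) * base (cellCounts A B) ^ n))
alternatingSum-cellCounts n = sumVec-cong n (λ A → trans (*-distribˡ-sumVec n (sgn A) _) (sumVec-cong n (λ B →
  trans (sym (ℤₚ.*-assoc (sgn A) (sgn B) _))
        (cong₂ _*_ (sgn-cellCounts A B) (cong (_^ n) (totalWeight-cellCounts A B))))))

-- Pairs of subsets with given cell counts

pairCount : ℕ → Counts → ℕ
pairCount m s = ℕΣ.sumVec m (λ A → ℕΣ.sumVec m (λ B → ℕΣ.𝟙 (cellCounts A B ≟ᶜ s)))

denominator : Counts → ℕ
denominator (s₀₀ , s₁₀ , s₀₁ , s₁₁) = (s₀₀ ! ℕ.* s₁₀ !) ℕ.* (s₀₁ ! ℕ.* s₁₁ !)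

cell-bump : ∀ a b s → cell a b (bump a b s) ≡ suc (cell a b s)
cell-bump 0F 0F _ = refl
cell-bump 1F 0F _ = refl
cell-bump 0F 1F _ = refl
cell-bump 1F 1F _ = refl

bump-view : ∀ a b s → cell a b s ≡ 0 ⊎ ∃ λ s′ → bump a b s′ ≡ s
bump-view 0F 0F (zero    , _ , _ , _) = inj₁ refl
bump-view 0F 0F (suc s₀₀ , s₁₀ , s₀₁ , s₁₁) = inj₂ ((s₀₀ , s₁₀ , s₀₁ , s₁₁) , refl)
bump-view 1F 0F (_ , zero , _ , _) = inj₁ refl
bump-view 1F 0F (s₀₀ , suc s₁₀ , s₀₁ , s₁₁) = inj₂ ((s₀₀ , s₁₀ , s₀₁ , s₁₁) , refl)
bump-view 0F 1F (_ , _ , zero , _) = inj₁ refl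
bump-view 0F 1F (s₀₀ , s₁₀ , suc s₀₁ , s₁₁) = inj₂ ((s₀₀ , s₁₀ , s₀₁ , s₁₁) , refl)
bump-view 1F 1F (_ , _ , _ , zero) = inj₁ refl
bump-view 1F 1F (s₀₀ , s₁₀ , s₀₁ , suc s₁₁) = inj₂ ((s₀₀ , s₁₀ , s₀₁ , s₁₁) , refl)

denominator-bump : ∀ a b s → denominator (bump a b s) ≡ suc (cell a b s) ℕ.* denominator s
denominator-bump 0F 0F (s₀₀ , s₁₀ , s₀₁ , s₁₁) = lemma (suc s₀₀) (s₀₀ !) (s₁₀ !) (s₀₁ !) (s₁₁ !)
  where
  lemma : ∀ k p q r s → (k ℕ.* p ℕ.* q) ℕ.* (r ℕ.* s) ≡ k ℕ.* ((p ℕ.* q) ℕ.* (r ℕ.* s))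
  lemma = ℕ-Solver.solve-∀
denominator-bump 1F 0F (s₀₀ , s₁₀ , s₀₁ , s₁₁) = lemma (suc s₁₀) (s₀₀ !) (s₁₀ !) (s₀₁ !) (s₁₁ !)
  where
  lemma : ∀ k p q r s → (p ℕ.* (k ℕ.* q)) ℕ.* (r ℕ.* s) ≡ k ℕ.* ((p ℕ.* q) ℕ.* (r ℕ.* s))
  lemma = ℕ-Solver.solve-∀
denominator-bump 0F 1F (s₀₀ , s₁₀ , s₀₁ , s₁₁) = lemma (suc s₀₁) (s₀₀ !) (s₁₀ !) (s₀₁ !) (s₁₁ !)
  where
  lemma : ∀ k p q r s → (p ℕ.* q) ℕ.* (k ℕ.* r ℕ.* s) ≡ k ℕ.* ((p ℕ.* q) ℕ.* (r ℕ.* s))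
  lemma = ℕ-Solver.solve-∀
denominator-bump 1F 1F (s₀₀ , s₁₀ , s₀₁ , s₁₁) = lemma (suc s₁₁) (s₀₀ !) (s₁₀ !) (s₀₁ !) (s₁₁ !)
  where
  lemma : ∀ k p q r s → (p ℕ.* q) ℕ.* (r ℕ.* (k ℕ.* s)) ≡ k ℕ.* ((p ℕ.* q) ℕ.* (r ℕ.* s))
  lemma = ℕ-Solver.solve-∀

extensionCount : ℕ → Fin 2 → Fin 2 → Counts → ℕ
extensionCount m a b s = ℕΣ.sumVec m (λ A → ℕΣ.sumVec m (λ B → ℕΣ.𝟙 (bump a b (cellCounts A B) ≟ᶜ s)))

pairCount-suc : ∀ m s → pairCount (suc m) s ≡ ℕΣ.sum (λ a → ℕΣ.sum (λ b → extensionCount m a b s))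
pairCount-suc m s = ℕΣ.sum-cong-≋ {2} (λ a →
  sym (ℕΣ.sum-sumVec-comm m (λ b A → ℕΣ.sumVec m (λ B → ℕΣ.𝟙 (bump a b (cellCounts A B) ≟ᶜ s)))))

extensionCount-bump : ∀ m a b s → extensionCount m a b (bump a b s) ≡ pairCount m s
extensionCount-bump m 0F 0F s = refl
extensionCount-bump m 1F 0F s = refl
extensionCount-bump m 0F 1F s = refl
extensionCount-bump m 1F 1F s = refl

extensionCount-empty : ∀ m a b s → cell a b s ≡ 0 → extensionCount m a b s ≡ 0
extensionCount-empty m a b s empty =
  ℕΣ.sumVec-zero m (λ A → ℕΣ.sumVec-zero m (λ B → ℕΣ.𝟙-no (bump a b (cellCounts A B) ≟ᶜ s) (absent _)))
  where
  absent : ∀ t → bump a b t ≢ s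
  absent t eq = ℕₚ.0≢1+n (trans (sym empty) (trans (cong (cell a b) (sym eq)) (cell-bump a b t)))

sum-cells : ∀ s k → ℕΣ.sum (λ a → ℕΣ.sum (λ b → cell a b s ℕ.* k)) ≡ total s ℕ.* k
sum-cells (s₀₀ , s₁₀ , s₀₁ , s₁₁) = lemma s₀₀ s₁₀ s₀₁ s₁₁
  where
  lemma : ∀ p q r s k → p ℕ.* k ℕ.+ (r ℕ.* k ℕ.+ 0) ℕ.+ (q ℕ.* k ℕ.+ (s ℕ.* k ℕ.+ 0) ℕ.+ 0) ≡
                        (p ℕ.+ q ℕ.+ r ℕ.+ s) ℕ.* k
  lemma = ℕ-Solver.solve-∀

extensionCount-factorial : ∀ m → (∀ s → total s ≡ m → pairCount m s ℕ.* denominator s ≡ m !) →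
                           ∀ a b s → total s ≡ suc m →
                           extensionCount m a b s ℕ.* denominator s ≡ cell a b s ℕ.* m !
extensionCount-factorial m factorialₘ a b s total≡ with bump-view a b s
... | inj₁ empty =
  trans (cong (ℕ._* denominator s) (extensionCount-empty m a b s empty)) (cong (ℕ._* m !) (sym empty))
... | inj₂ (s′ , refl) = begin
  extensionCount m a b (bump a b s′) ℕ.* denominator (bump a b s′)
    ≡⟨ cong₂ ℕ._*_ (extensionCount-bump m a b s′) (denominator-bump a b s′) ⟩
  pairCount m s′ ℕ.* (suc (cell a b s′) ℕ.* denominator s′)
    ≡⟨ ℕₚ.*-comm (pairCount m s′) _ ⟩
  suc (cell a b s′) ℕ.* denominator s′ ℕ.* pairCount m s′
    ≡⟨ ℕₚ.*-assoc (suc (cell a b s′)) (denominator s′) (pairCount m s′) ⟩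
  suc (cell a b s′) ℕ.* (denominator s′ ℕ.* pairCount m s′)
    ≡⟨ cong (suc (cell a b s′) ℕ.*_) (trans (ℕₚ.*-comm (denominator s′) _) (factorialₘ s′ total′≡)) ⟩
  suc (cell a b s′) ℕ.* m !
    ≡⟨ cong (ℕ._* m !) (sym (cell-bump a b s′)) ⟩
  cell a b (bump a b s′) ℕ.* m !  ∎
  where
  total′≡ : total s′ ≡ m
  total′≡ = ℕₚ.suc-injective (trans (sym (total-bump a b s′)) total≡)

pairCount-factorial : ∀ m s → total s ≡ m → pairCount m s ℕ.* denominator s ≡ m !
pairCount-factorial zero (zero  , zero  , zero  , zero ) refl = refl
pairCount-factorial zero (suc _ , _     , _     , _    ) ()
pairCount-factorial zero (zero  , suc _ , _     , _    ) ()
pairCount-factorial zero (zero  , zero  , suc _ , _    ) ()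
pairCount-factorial zero (zero  , zero  , zero  , suc _) ()
pairCount-factorial (suc m) s total≡ = begin
  pairCount (suc m) s ℕ.* denominator s
    ≡⟨ cong (ℕ._* denominator s) (pairCount-suc m s) ⟩
  ℕΣ.sum (λ a → ℕΣ.sum (λ b → extensionCount m a b s)) ℕ.* denominator s
    ≡⟨ ℕΣ.*-distribʳ-sum (denominator s) (λ a → ℕΣ.sum (λ b → extensionCount m a b s)) ⟩
  ℕΣ.sum (λ a → ℕΣ.sum (λ b → extensionCount m a b s) ℕ.* denominator s)
    ≡⟨ ℕΣ.sum-cong-≋ {2} (λ a → ℕΣ.*-distribʳ-sum (denominator s) (λ b → extensionCount m a b s)) ⟩
  ℕΣ.sum (λ a → ℕΣ.sum (λ b → extensionCount m a b s ℕ.* denominator s))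
    ≡⟨ ℕΣ.sum-cong-≋ {2} (λ a → ℕΣ.sum-cong-≋ {2} (λ b →
         extensionCount-factorial m (pairCount-factorial m) a b s total≡)) ⟩
  ℕΣ.sum (λ a → ℕΣ.sum (λ b → cell a b s ℕ.* m !))
    ≡⟨ sum-cells s (m !) ⟩
  total s ℕ.* m !
    ≡⟨ cong (ℕ._* m !) total≡ ⟩
  suc m ! ∎

pairCount-≢ : ∀ m s → total s ≢ m → pairCount m s ≡ 0
pairCount-≢ m s total≢ = ℕΣ.sumVec-zero m (λ A → ℕΣ.sumVec-zero m (λ B →
  ℕΣ.𝟙-no (cellCounts A B ≟ᶜ s) (λ eq → total≢ (trans (cong total (sym eq)) (total-cellCounts A B)))))

multinomial4≡pairCount : ∀ m s₀₀ s₁₀ s₀₁ s₁₁ → total (s₀₀ , s₁₀ , s₀₁ , s₁₁) ≡ m →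
                         multinomial4 m s₀₀ s₁₀ s₀₁ s₁₁ ≡ pairCount m (s₀₀ , s₁₀ , s₀₁ , s₁₁)
multinomial4≡pairCount m s₀₀ s₁₀ s₀₁ s₁₁ total≡ =
  trans (cong (λ k → (k ℕ./ denominator s) {{denominator≢0}}) (sym (pairCount-factorial m s total≡)))
        (DivMod.m*n/n≡m (pairCount m s) (denominator s) {{denominator≢0}})
  where
  s : Counts
  s = s₀₀ , s₁₀ , s₀₁ , s₁₁
  denominator≢0 : NonZero (denominator s)
  denominator≢0 = ℕₚ.m*n≢0 _ _ {{ℕₚ.m*n≢0 _ _ {{s₀₀ ℕₚ.!≢0}} {{s₁₀ ℕₚ.!≢0}}}}
                               {{ℕₚ.m*n≢0 _ _ {{s₀₁ ℕₚ.!≢0}} {{s₁₁ ℕₚ.!≢0}}}}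

pos-pairCount : ∀ m s → + pairCount m s ≡ sumVec m (λ A → sumVec m (λ B → 𝟙 (cellCounts A B ≟ᶜ s)))
pos-pairCount m s = trans (pos-sumVec m _) (sumVec-cong m (λ A →
  trans (pos-sumVec m _) (sumVec-cong m (λ B → pos-𝟙 (cellCounts A B ≟ᶜ s)))))

toCounts : ∀ {k} → Vec (Fin k) 4 → Counts
toCounts (p ∷ q ∷ r ∷ s ∷ []) = toℕ p , toℕ q , toℕ r , toℕ s

fromCounts : Counts → Vec ℕ 4
fromCounts (p , q , r , s) = p ∷ q ∷ r ∷ s ∷ []

𝟙-≟ᶜ-toCounts : ∀ {k} s (v : Vec (Fin k) 4) →
                𝟙 (s ≟ᶜ toCounts v) ≡ ∏ (λ j → 𝟙 (lookup (fromCounts s) j ≟ⁿ toℕ (lookup v j)))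
𝟙-≟ᶜ-toCounts (p , q , r , s) (p′ ∷ q′ ∷ r′ ∷ s′ ∷ []) =
  trans (𝟙-×-dec (p ≟ⁿ toℕ p′) (q ≟ⁿ toℕ q′ ×-dec r ≟ⁿ toℕ r′ ×-dec s ≟ⁿ toℕ s′)) (cong (𝟙 (p ≟ⁿ toℕ p′) *_)
  (trans (𝟙-×-dec (q ≟ⁿ toℕ q′) (r ≟ⁿ toℕ r′ ×-dec s ≟ⁿ toℕ s′)) (cong (𝟙 (q ≟ⁿ toℕ q′) *_)
  (trans (𝟙-×-dec (r ≟ⁿ toℕ r′) (s ≟ⁿ toℕ s′)) (cong (𝟙 (r ≟ⁿ toℕ r′) *_)
  (sym (ℤₚ.*-identityʳ _)))))))

sum-𝟙-≟ᶜ-toCounts : ∀ {k} s → (∀ j → lookup (fromCounts s) j < k) →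
                    sumVec 4 (λ v → 𝟙 (s ≟ᶜ toCounts {k} v)) ≡ 1ℤ
sum-𝟙-≟ᶜ-toCounts {k} s bounded = begin
  sumVec 4 (λ v → 𝟙 (s ≟ᶜ toCounts {k} v))
    ≡⟨ sumVec-cong {k} 4 (𝟙-≟ᶜ-toCounts s) ⟩
  sumVec {k} 4 (λ v → ∏ (λ j → 𝟙 (lookup (fromCounts s) j ≟ⁿ toℕ (lookup v j))))
    ≡⟨ sumVec-∏ {k} 4 (λ j x → 𝟙 (lookup (fromCounts s) j ≟ⁿ toℕ x)) ⟩
  ∏ (λ j → sum {k} (λ x → 𝟙 (lookup (fromCounts s) j ≟ⁿ toℕ x)))
    ≡⟨ ∏-one (λ j → sum {k} (λ x → 𝟙 (lookup (fromCounts s) j ≟ⁿ toℕ x))) (λ j → sum-𝟙-toℕ _ (bounded j)) ⟩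
  1ℤ   ∎

component≤total : ∀ s j → lookup (fromCounts s) j ℕ.≤ total s
component≤total (s₀₀ , s₁₀ , s₀₁ , s₁₁) 0F =
  ℕₚ.≤-trans (ℕₚ.m≤m+n s₀₀ s₁₀) (ℕₚ.≤-trans (ℕₚ.m≤m+n _ s₀₁) (ℕₚ.m≤m+n _ s₁₁))
component≤total (s₀₀ , s₁₀ , s₀₁ , s₁₁) 1F =
  ℕₚ.≤-trans (ℕₚ.m≤n+m s₁₀ s₀₀) (ℕₚ.≤-trans (ℕₚ.m≤m+n _ s₀₁) (ℕₚ.m≤m+n _ s₁₁))
component≤total (s₀₀ , s₁₀ , s₀₁ , s₁₁) 2F = ℕₚ.≤-trans (ℕₚ.m≤n+m s₀₁ (s₀₀ ℕ.+ s₁₀)) (ℕₚ.m≤m+n _ s₁₁)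
component≤total (s₀₀ , s₁₀ , s₀₁ , s₁₁) 3F = ℕₚ.m≤n+m s₁₁ (s₀₀ ℕ.+ s₁₀ ℕ.+ s₀₁)

pairCount-* : ∀ m s (g : Counts → ℤ) →
              + pairCount m s * g s ≡ sumVec m (λ A → sumVec m (λ B → 𝟙 (cellCounts A B ≟ᶜ s) * g (cellCounts A B)))
pairCount-* m s g = begin
  + pairCount m s * g s
    ≡⟨ cong (_* g s) (pos-pairCount m s) ⟩
  sumVec m (λ A → sumVec m (λ B → 𝟙 (cellCounts A B ≟ᶜ s))) * g s
    ≡⟨ *-distribʳ-sumVec m (g s) _ ⟩
  sumVec m (λ A → sumVec m (λ B → 𝟙 (cellCounts A B ≟ᶜ s)) * g s)
    ≡⟨ sumVec-cong m (λ A → *-distribʳ-sumVec m (g s) _) ⟩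
  sumVec m (λ A → sumVec m (λ B → 𝟙 (cellCounts A B ≟ᶜ s) * g s))
    ≡⟨ sumVec-cong m (λ A → sumVec-cong m (λ B → 𝟙-*-subst g (cellCounts A B ≟ᶜ s))) ⟩
  sumVec m (λ A → sumVec m (λ B → 𝟙 (cellCounts A B ≟ᶜ s) * g (cellCounts A B)))   ∎

sum-by-cellCounts : ∀ m (g : Counts → ℤ) →
                    sumVec 4 (λ v → + pairCount m (toCounts {suc m} v) * g (toCounts v)) ≡
                    sumVec m (λ A → sumVec m (λ B → g (cellCounts A B)))
sum-by-cellCounts m g = begin
  sumVec 4 (λ v → + pairCount m (toCounts {suc m} v) * g (toCounts v))
    ≡⟨ sumVec-cong {suc m} 4 (λ v → pairCount-* m (toCounts v) g) ⟩
  sumVec 4 (λ v → sumVec m (λ A → sumVec m (λ B → δ A B v * g (cellCounts A B))))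
    ≡⟨ sumVec-comm 4 m (λ v A → sumVec m (λ B → δ A B v * g (cellCounts A B))) ⟩
  sumVec m (λ A → sumVec 4 (λ v → sumVec m (λ B → δ A B v * g (cellCounts A B))))
    ≡⟨ sumVec-cong m (λ A → sumVec-comm 4 m (λ v B → δ A B v * g (cellCounts A B))) ⟩
  sumVec m (λ A → sumVec m (λ B → sumVec 4 (λ v → δ A B v * g (cellCounts A B))))
    ≡⟨ sumVec-cong m (λ A → sumVec-cong m (λ B → sym (*-distribʳ-sumVec 4 (g (cellCounts A B)) (δ A B)))) ⟩
  sumVec m (λ A → sumVec m (λ B → sumVec 4 (δ A B) * g (cellCounts A B)))
    ≡⟨ sumVec-cong m (λ A → sumVec-cong m (λ B → trans (cong (_* g (cellCounts A B)) (occurs-once A B))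
                                                         (ℤₚ.*-identityˡ _))) ⟩
  sumVec m (λ A → sumVec m (λ B → g (cellCounts A B)))   ∎
  where
  δ : Vec (Fin 2) m → Vec (Fin 2) m → Vec (Fin (suc m)) 4 → ℤ
  δ A B v = 𝟙 (cellCounts A B ≟ᶜ toCounts v)
  occurs-once : ∀ A B → sumVec 4 (δ A B) ≡ 1ℤ
  occurs-once A B = sum-𝟙-≟ᶜ-toCounts (cellCounts A B) (λ j →
    ℕ.s≤s (ℕₚ.≤-trans (component≤total (cellCounts A B) j) (ℕₚ.≤-reflexive (total-cellCounts A B))))

formulaL2-box : ∀ n →
                formulaL2 n ≡ sumVec 4 (λ v → 𝟙 (total (toCounts {suc n} v) ≟ⁿ n) * term n (toCounts v))
formulaL2-box n = begin
  formulaL2 n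
    ≡⟨ listSum-filter P? (term n) (concatMap G₁ U) ⟩
  listSum F (concatMap G₁ U)
    ≡⟨ listSum-concatMap-upTo F G₁ (suc n) ⟩
  sum {suc n} (λ a → listSum F (G₁ (toℕ a)))
    ≡⟨ sum-cong-≋ {suc n} (λ a → trans (listSum-concatMap-upTo F (G₂ (toℕ a)) (suc n)) (sum-cong-≋ {suc n} (λ b →
         trans (listSum-concatMap-upTo F (G₃ (toℕ a) (toℕ b)) (suc n)) (sum-cong-≋ {suc n} (λ c →
           listSum-map-upTo F (λ d → toℕ a , toℕ b , toℕ c , d) (suc n)))))) ⟩
  sumVec 4 (λ v → 𝟙 (total (toCounts {suc n} v) ≟ⁿ n) * term n (toCounts v))   ∎
  where
  U : List ℕ
  U = upTo (suc n)
  G₃ : ℕ → ℕ → ℕ → List Counts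
  G₃ a b c = map (λ d → a , b , c , d) U
  G₂ : ℕ → ℕ → List Counts
  G₂ a b = concatMap (G₃ a b) U
  G₁ : ℕ → List Counts
  G₁ a = concatMap (G₂ a) U
  P? : ∀ s → Dec (total s ≡ n)
  P? s = total s ≟ⁿ n
  F : Counts → ℤ
  F s = 𝟙 (P? s) * term n s

term≡pairCount : ∀ n s → 𝟙 (total s ≟ⁿ n) * term n s ≡ + pairCount n s * (sign s * base s ^ n)
term≡pairCount n (s₀₀ , s₁₀ , s₀₁ , s₁₁) = by-total (total s ≟ⁿ n)
  where
  s : Counts
  s = s₀₀ , s₁₀ , s₀₁ , s₁₁
  by-total : (total? : Dec (total s ≡ n)) → 𝟙 total? * term n s ≡ + pairCount n s * (sign s * base s ^ n)
  by-total (no total≢)  = cong (λ k → + k * (sign s * base s ^ n)) (sym (pairCount-≢ n s total≢))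
  by-total (yes total≡) = begin
    1ℤ * (sign s * + multinomial4 n s₀₀ s₁₀ s₀₁ s₁₁ * base s ^ n)
      ≡⟨ ℤₚ.*-identityˡ _ ⟩
    sign s * + multinomial4 n s₀₀ s₁₀ s₀₁ s₁₁ * base s ^ n
      ≡⟨ cong (λ k → sign s * + k * base s ^ n) (multinomial4≡pairCount n s₀₀ s₁₀ s₀₁ s₁₁ total≡) ⟩
    sign s * + pairCount n s * base s ^ n
      ≡⟨ cong (_* base s ^ n) (ℤₚ.*-comm (sign s) _) ⟩
    + pairCount n s * sign s * base s ^ n
      ≡⟨ ℤₚ.*-assoc (+ pairCount n s) (sign s) _ ⟩
    + pairCount n s * (sign s * base s ^ n)   ∎

LatinRows : ℕ → Set
LatinRows n = Σ (Vec (Fin n) n) (λ r₀ → Σ (Vec (Fin n) n) (λ r₁ → T (does (latin? (r₀ ∷ r₁ ∷ [])))))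

LatinRect₂↔LatinRows : ∀ n → LatinRect 2 n ↔ LatinRows n
LatinRect₂↔LatinRows n =
  mk↔ₛ′ to from (λ (r₀ , r₁ , _) → cong (λ t → r₀ , r₁ , t) (T-irrelevant _ _))
                (λ { (latinRect (_ ∷ _ ∷ []) _) → refl })
  where
  to : LatinRect 2 n → LatinRows n
  to (latinRect (r₀ ∷ r₁ ∷ []) isLatin) =
    r₀ , r₁ , Equivalence.from (T-does (latin? (r₀ ∷ r₁ ∷ []))) (recompute (latin? (r₀ ∷ r₁ ∷ [])) isLatin)
  from : LatinRows n → LatinRect 2 n
  from (r₀ , r₁ , t) = latinRect (r₀ ∷ r₁ ∷ []) (Equivalence.to (T-does (latin? (r₀ ∷ r₁ ∷ []))) t)

latinCount : ℕ → ℕ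
latinCount n = ℕΣ.sumVec n (λ r₀ → ℕΣ.sumVec n (λ r₁ → ℕΣ.𝟙 (latin? (r₀ ∷ r₁ ∷ []))))

LatinRect₂↔Fin : ∀ n → LatinRect 2 n ↔ Fin (latinCount n)
LatinRect₂↔Fin n =
  ↔-trans (LatinRect₂↔LatinRows n) (↔-trans (Σ.congˡ (Σ.congˡ (T↔Fin _)))
  (↔-trans (Σ.congˡ (Σ-sumVec↔ n _)) (Σ-sumVec↔ n _)))

pos-latinCount : ∀ n → + latinCount n ≡ sumVec n (λ r₀ → sumVec n (λ r₁ → 𝟙 (latin? (r₀ ∷ r₁ ∷ []))))
pos-latinCount n = trans (pos-sumVec n _) (sumVec-cong n (λ r₀ →
  trans (pos-sumVec n _) (sumVec-cong n (λ r₁ → pos-𝟙 (latin? (r₀ ∷ r₁ ∷ []))))))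

latinCount-formulaL2 : ∀ n → + latinCount n ≡ formulaL2 n
latinCount-formulaL2 n = begin
  + latinCount n
    ≡⟨ pos-latinCount n ⟩
  sumVec n (λ r₀ → sumVec n (λ r₁ → 𝟙 (latin? (r₀ ∷ r₁ ∷ []))))
    ≡⟨ latinCount-alternating n ⟩
  alternatingSum n (λ A → alternatingSum n (λ B → totalWeight A B ^ n))
    ≡⟨ alternatingSum-cellCounts n ⟩
  sumVec n (λ A → sumVec n (λ B → G (cellCounts A B)))
    ≡⟨ sum-by-cellCounts n G ⟨
  sumVec 4 (λ v → + pairCount n (toCounts {suc n} v) * G (toCounts v))
    ≡⟨ sumVec-cong {suc n} 4 (λ v → term≡pairCount n (toCounts v)) ⟨
  sumVec 4 (λ v → 𝟙 (total (toCounts {suc n} v) ≟ⁿ n) * term n (toCounts v))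
    ≡⟨ formulaL2-box n ⟨
  formulaL2 n   ∎
  where
  G : Counts → ℤ
  G s = sign s * base s ^ n

mainTheorem5 : (n : ℕ) → 1 ≤ n →
    Σ ℕ (λ L₂ → (LatinRect 2 n ↔ Fin L₂) × (+ L₂ ≡ formulaL2 n))
mainTheorem5 n _ = latinCount n , LatinRect₂↔Fin n , latinCount-formulaL2 n
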